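{- Let $T=(V,E)$ be a finite forest, $\ll$ a presentation order of $V$, and $i\ge 2$ an integer. If First-Fit uses color $i$ when coloring $T$ in order $\ll$, then there is a bidirected path in $T^{\ll}$ with exactly $2i-2$ vertices.
   Context: First-Fit processes the vertices in the order $\ll$ and assigns to each vertex the least positive integer not already used as a color on one of its previously processed neighbors. $T^{\ll}$ denotes the directed graph obtained from $T$ by orienting each edge $\{u,v\}$ from $u$ to $v$ if and only if $u\ll v$. A simple path $P$ in a directed graph is called bidirected if either it is a directed path, or it can be split into two directed paths, each starting at one of the endpoints of $P$, and both having the same last vertex. -}

module Defs where

open import Data.Nat using (ℕ; zero; suc; _≤_; _<_; _∸_)
open import Data.Fin using (Fin)
open import Data.Product using (Σ; _×_; ∃)
open import Relation.Binary.PropositionalEquality using (_≡_; _≢_)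
open import Relation.Nullary using (¬_)

record Graph (n : ℕ) : Set₁ where
  field
    Adj     : Fin n → Fin n → Set
    sym     : ∀ {u v} → Adj u v → Adj v u
    irrefl  : ∀ {u} → ¬ Adj u u

open Graph public

-- A sequence p 0, …, p (k-1) of vertices, given as a function ℕ → Fin n
-- (values at indices ≥ k are irrelevant), with pairwise distinct entries.
DistinctOn : ∀ {n} → ℕ → (ℕ → Fin n) → Set
DistinctOn k p = ∀ a b → a < k → b < k → p a ≡ p b → a ≡ b

Walk : ∀ {n} → Graph n → ℕ → (ℕ → Fin n) → Set
Walk G k p = ∀ j → suc j < k → Adj G (p j) (p (suc j))

IsCycle : ∀ {n} → Graph n → ℕ → (ℕ → Fin n) → Set
IsCycle G k p = 3 ≤ k × DistinctOn k p × Walk G k p × Adj G (p (k ∸ 1)) (p 0)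

IsForest : ∀ {n} → Graph n → Set
IsForest G = ∀ k p → ¬ IsCycle G k p

-- A presentation order (a linear order ≪ on the vertices) is given by an
-- injective rank function into ℕ:  u ≪ v  iff  rank u < rank v.
record Order (n : ℕ) : Set where
  field
    rank    : Fin n → ℕ
    rank-inj : ∀ u v → rank u ≡ rank v → u ≡ v

open Order public

_≪[_]_ : ∀ {n} → Fin n → Order n → Fin n → Set
u ≪[ O ] v = rank O u < rank O v

-- c is the coloring produced by First-Fit on G in order O: each vertex v
-- receives the least positive integer not used as a color on a previously
-- processed neighbour of v.
IsFirstFit : ∀ {n} → Graph n → Order n → (Fin n → ℕ) → Set
IsFirstFit G O c = ∀ v →
    1 ≤ c v
  × (∀ u → Adj G u v → u ≪[ O ] v → c u ≢ c v)
  × (∀ k → 1 ≤ k → k < c v → ∃ λ u → Adj G u v × u ≪[ O ] v × c u ≡ k)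

-- A bidirected path in G^≪ with k vertices p 0, …, p (k-1): a simple path
-- (distinct vertices, consecutive adjacent) and an index m < k such that
-- p 0 ≪ p 1 ≪ … ≪ p m and p (k-1) ≪ p (k-2) ≪ … ≪ p m.
-- (m = 0 or m = k-1 gives the directed-path case.)
IsBidirectedPath : ∀ {n} → Graph n → Order n → ℕ → (ℕ → Fin n) → Set
IsBidirectedPath G O k p =
    DistinctOn k p × Walk G k p
  × Σ ℕ λ m → m < k
      × (∀ j → suc j ≤ m → p j ≪[ O ] p (suc j))
      × (∀ j → m ≤ j → suc j < k → p (suc j) ≪[ O ] p j)

-- Let v have colour i = K + 2. First-Fit gives every vertex an earlier neighbour of each smaller
-- colour, so following earlier neighbours of colours K + 1, K, …, 1 gives a rising walk into v, and
-- following those of colours K, K - 1, …, 1 a falling walk out of v: together a bidirected walk on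
-- 2K + 2 = 2i - 2 vertices. Away from the peak v the walk is strictly monotone in ≪, and the two
-- neighbours of v have the distinct colours K + 1 and K, so it never backtracks. In a forest a
-- non-backtracking walk is a path: the first return to an earlier vertex would close a cycle.
{-# OPTIONS --safe #-}
module Submission where

open import Defs hiding (sym)
open import Data.Nat using (ℕ; zero; suc; _+_; _≤_; _<_; _∸_; _*_; z≤n; s≤s; z<s; s≤s⁻¹)
open import Data.Nat.Properties
  using ( <-cmp; ≤-refl; <-trans; <-irrefl; <⇒≤; ≤-trans; ≤-reflexive; n≤1+n; m≤n⇒m<n∨m≡n
        ; suc-injective; 1+n≢n; +-suc; +-comm; +-identityʳ )
open import Data.Fin using (Fin)
open import Data.Product using (Σ; ∃; _×_; _,_; proj₂)
open import Data.Sum using (inj₁; inj₂)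
open import Data.Empty using (⊥-elim)
open import Function using (_∘_)
open import Relation.Binary.Definitions using (tri<; tri≈; tri>)
open import Relation.Binary.PropositionalEquality
  using (_≡_; _≢_; refl; sym; trans; cong; subst; subst₂; ≢-sym; module ≡-Reasoning)

infixr 5 _∷_

_∷_ : ∀ {a} {A : Set a} → A → (ℕ → A) → ℕ → A
(x ∷ p) zero    = x
(x ∷ p) (suc j) = p j

NonBacktracking : ∀ {n} → ℕ → (ℕ → Fin n) → Set
NonBacktracking k p = ∀ j → suc (suc j) < k → p j ≢ p (suc (suc j))

module _ {n} (G : Graph n) where

  walk-mono : ∀ {k l p} → k ≤ l → Walk G l p → Walk G k p
  walk-mono k≤l w j j<k = w j (≤-trans j<k k≤l)

  walk-∷ : ∀ {k x p} → Adj G x (p 0) → Walk G k p → Walk G (suc k) (x ∷ p)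
  walk-∷ adj w zero    _         = adj
  walk-∷ adj w (suc j) (s≤s j<k) = w j j<k

nonBacktracking-mono : ∀ {n k l} {p : ℕ → Fin n}
  → k ≤ l → NonBacktracking l p → NonBacktracking k p
nonBacktracking-mono k≤l nb j j<k = nb j (≤-trans j<k k≤l)

distinct-mono : ∀ {n k l} {p : ℕ → Fin n} → k ≤ l → DistinctOn l p → DistinctOn k p
distinct-mono k≤l d a b a<k b<k = d a b (≤-trans a<k k≤l) (≤-trans b<k k≤l)

distinct-∷ : ∀ {n k} {p : ℕ → Fin n}
  → DistinctOn k (p ∘ suc) → (∀ j → j < k → p 0 ≢ p (suc j)) → DistinctOn (suc k) p
distinct-∷ d fresh zero    zero    _         _         _  = refl
distinct-∷ d fresh zero    (suc b) _         (s≤s b<k) eq = ⊥-elim (fresh b b<k eq)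
distinct-∷ d fresh (suc a) zero    (s≤s a<k) _         eq = ⊥-elim (fresh a a<k (sym eq))
distinct-∷ d fresh (suc a) (suc b) (s≤s a<k) (s≤s b<k) eq = cong suc (d a b a<k b<k eq)

module _ {n} {G : Graph n} (forest : IsForest G) where

  closed-walk-backtracks : ∀ m {p} → Walk G (suc (suc m)) p → NonBacktracking (suc (suc m)) p
    → DistinctOn (suc m) p → p (suc m) ≢ p 0
  closed-walk-backtracks zero          w nb d eq = irrefl G (subst (Adj G _) eq (w 0 ≤-refl))
  closed-walk-backtracks (suc zero)    w nb d eq = nb 0 (s≤s (s≤s (s≤s z≤n))) (sym eq)
  closed-walk-backtracks (suc (suc m)) {p} w nb d eq =
    forest (suc (suc (suc m))) p (s≤s (s≤s (s≤s z≤n)) , d , walk-mono G (n≤1+n _) w , closing)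
    where
      closing : Adj G (p (suc (suc m))) (p 0)
      closing = subst (Adj G _) eq (w (suc (suc m)) ≤-refl)

  nonBacktracking-walk-distinct : ∀ k {p} → Walk G k p → NonBacktracking k p → DistinctOn k p
  nonBacktracking-walk-distinct zero          w nb a b ()
  nonBacktracking-walk-distinct (suc k) {p} w nb = distinct-∷ tail-distinct head-fresh
    where
      tail-distinct : DistinctOn k (p ∘ suc)
      tail-distinct =
        nonBacktracking-walk-distinct k (λ j j<k → w (suc j) (s≤s j<k)) (λ j j<k → nb (suc j) (s≤s j<k))

      head-fresh : ∀ j → j < k → p 0 ≢ p (suc j)
      head-fresh j j<k eq =
        closed-walk-backtracks j (walk-mono G (s≤s j<k) w) (nonBacktracking-mono (s≤s j<k) nb)
          (distinct-∷ (distinct-mono (<⇒≤ j<k) tail-distinct) earlier-fresh) (sym eq)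
        where
          earlier-fresh : ∀ t → t < j → p 0 ≢ p (suc t)
          earlier-fresh t t<j eq′ =
            <-irrefl (tail-distinct t j (<-trans t<j j<k) j<k (trans (sym eq′) eq)) t<j

record BidirectedWalk {n} (G : Graph n) (O : Order n) (k m : ℕ) (p : ℕ → Fin n) : Set where
  field
    walk    : Walk G k p
    peak<   : m < k
    rising  : ∀ j → suc j ≤ m → p j ≪[ O ] p (suc j)
    falling : ∀ j → m ≤ j → suc j < k → p (suc j) ≪[ O ] p j

open BidirectedWalk

module _ {n} {G : Graph n} {O : Order n} where

  bidirected-singleton : ∀ {p} → BidirectedWalk G O 1 0 p
  bidirected-singleton = record
    { walk = λ { _ (s≤s ()) } ; peak< = z<s ; rising = λ _ () ; falling = λ { _ _ (s≤s ()) } }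

  bidirected-∷-rising : ∀ {k m x p} → Adj G x (p 0) → x ≪[ O ] p 0
    → BidirectedWalk G O k m p → BidirectedWalk G O (suc k) (suc m) (x ∷ p)
  bidirected-∷-rising {x = x} {p} adj x≪p₀ W = record
    { walk = walk-∷ G adj (walk W) ; peak< = s≤s (peak< W) ; rising = rises ; falling = falls }
    where
      rises : ∀ j → suc j ≤ suc _ → (x ∷ p) j ≪[ O ] (x ∷ p) (suc j)
      rises zero    _         = x≪p₀
      rises (suc j) (s≤s j<m) = rising W j j<m
      falls : ∀ j → suc _ ≤ j → suc j < suc _ → (x ∷ p) (suc j) ≪[ O ] (x ∷ p) j
      falls (suc j) (s≤s m≤j) (s≤s j<k) = falling W j m≤j j<k

  bidirected-∷-falling : ∀ {k x p} → Adj G x (p 0) → p 0 ≪[ O ] x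
    → BidirectedWalk G O k 0 p → BidirectedWalk G O (suc k) 0 (x ∷ p)
  bidirected-∷-falling {x = x} {p} adj p₀≪x W = record
    { walk = walk-∷ G adj (walk W) ; peak< = z<s ; rising = λ _ () ; falling = falls }
    where
      falls : ∀ j → 0 ≤ j → suc j < suc _ → (x ∷ p) (suc j) ≪[ O ] (x ∷ p) j
      falls zero    _ _         = p₀≪x
      falls (suc j) _ (s≤s j<k) = falling W j z≤n j<k

  ≪⇒≢ : ∀ {u v} → u ≪[ O ] v → u ≢ v
  ≪⇒≢ u≪v refl = <-irrefl refl u≪v

  bidirected-nonBacktracking : ∀ {k m p} → BidirectedWalk G O k m p
    → (∀ j → suc j ≡ m → suc (suc j) < k → p j ≢ p (suc (suc j)))
    → NonBacktracking k p
  bidirected-nonBacktracking {m = m} W at-peak j j+2<k with <-cmp (suc j) m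
  ... | tri< j+1<m _ _ = ≪⇒≢ (<-trans (rising W j (<⇒≤ j+1<m)) (rising W (suc j) j+1<m))
  ... | tri≈ _ j+1≡m _ = at-peak j j+1≡m j+2<k
  ... | tri> _ _ m<j+1 = ≢-sym (≪⇒≢ (<-trans (falling W (suc j) (<⇒≤ m<j+1) j+2<k)
                                            (falling W j (s≤s⁻¹ m<j+1) (<⇒≤ j+2<k))))

  forest-bidirected-path : IsForest G → ∀ {k m p} → BidirectedWalk G O k m p → NonBacktracking k p
    → IsBidirectedPath G O k p
  forest-bidirected-path forest {k} {m} W nb =
    nonBacktracking-walk-distinct {G = G} forest k (walk W) nb
    , walk W , m , peak< W , rising W , falling W

module FirstFit {n} {G : Graph n} {O : Order n} {c : Fin n → ℕ} (ff : IsFirstFit G O c) where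

  earlier-neighbour : ∀ {k} x → 1 ≤ k → k < c x → ∃ λ u → Adj G u x × u ≪[ O ] x × c u ≡ k
  earlier-neighbour x = proj₂ (proj₂ (ff x)) _

  falling-walk : ∀ k x → k < c x
    → Σ (ℕ → Fin n) λ d → BidirectedWalk G O (suc k) 0 (x ∷ d) × (∀ t → t < k → c (d t) ≡ k ∸ t)
  falling-walk zero    x _ = (λ _ → x) , bidirected-singleton , λ _ ()
  falling-walk (suc k) x k<cx with earlier-neighbour x (s≤s z≤n) k<cx
  ... | u , u~x , u≪x , cu≡k+1 with falling-walk k u (≤-reflexive (sym cu≡k+1))
  ... | d , W , colours = u ∷ d , bidirected-∷-falling (Graph.sym G u~x) u≪x W , colours′
    where
      colours′ : ∀ t → t < suc k → c ((u ∷ d) t) ≡ suc k ∸ t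
      colours′ zero    _         = cu≡k+1
      colours′ (suc t) (s≤s t<k) = colours t t<k

  prepend-rising-walk : ∀ k {l m e} → BidirectedWalk G O l m e → k < c (e 0)
    → Σ (ℕ → Fin n) λ p → BidirectedWalk G O (k + l) (k + m) p
        × (∀ t → p (k + t) ≡ e t) × (∀ j → j < k → c (p j) ≡ suc j)
  prepend-rising-walk zero W _ = _ , W , (λ _ → refl) , λ _ ()
  prepend-rising-walk (suc k) {l} {m} {e} W k<ce₀ with earlier-neighbour (e 0) (s≤s z≤n) k<ce₀
  ... | u , u~e₀ , u≪e₀ , cu≡k+1
    with prepend-rising-walk k (bidirected-∷-rising u~e₀ u≪e₀ W) (≤-reflexive (sym cu≡k+1))
  ... | p , W′ , p-extends , colours =
    p , subst₂ (λ l′ m′ → BidirectedWalk G O l′ m′ p) (+-suc k l) (+-suc k m) W′ , extends , colours′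
    where
      extends : ∀ t → p (suc k + t) ≡ e t
      extends t = trans (cong p (sym (+-suc k t))) (p-extends (suc t))
      colours′ : ∀ j → j < suc k → c (p j) ≡ suc j
      colours′ j (s≤s j≤k) with m≤n⇒m<n∨m≡n j≤k
      ... | inj₁ j<k  = colours j j<k
      ... | inj₂ refl =
        trans (cong (c ∘ p) (sym (+-identityʳ j))) (trans (cong c (p-extends 0)) cu≡k+1)

  bidirected-path-through : IsForest G → ∀ {K v} → c v ≡ suc (suc K)
    → Σ (ℕ → Fin n) λ p → IsBidirectedPath G O (suc K + suc K) p
  bidirected-path-through forest {K} {v} cv≡K+2
    with falling-walk K v (subst (K <_) (sym cv≡K+2) (n≤1+n (suc K)))
  ... | d , D , d-colours with prepend-rising-walk (suc K) D (≤-reflexive (sym cv≡K+2))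
  ... | p , W , p-extends , p-colours =
    p , forest-bidirected-path forest W (bidirected-nonBacktracking W peak-neighbours-differ)
    where
      open ≡-Reasoning

      2+k<2+2k⇒0<k : ∀ {k} → suc (suc k) < suc k + suc k → 0 < k
      2+k<2+2k⇒0<k {zero}  (s≤s (s≤s ()))
      2+k<2+2k⇒0<k {suc k} _ = z<s

      peak-neighbours-differ : ∀ j → suc j ≡ suc K + 0 → suc (suc j) < suc K + suc K
        → p j ≢ p (suc (suc j))
      peak-neighbours-differ j j+1≡K+1 j+2<len p-eq
        with suc-injective (trans j+1≡K+1 (cong suc (+-identityʳ K)))
      ... | refl = 1+n≢n (begin
        suc K                 ≡⟨ sym (p-colours K ≤-refl) ⟩
        c (p K)               ≡⟨ cong c p-eq ⟩
        c (p (suc (suc K)))   ≡⟨ cong (c ∘ p ∘ suc) (+-comm 1 K) ⟩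
        c (p (suc K + 1))     ≡⟨ cong c (p-extends 1) ⟩
        c (d 0)               ≡⟨ d-colours 0 (2+k<2+2k⇒0<k j+2<len) ⟩
        K                     ∎)

corollary1 : ∀ {n} (T : Graph n) → IsForest T → (O : Order n) → (i : ℕ) → 2 ≤ i
    → (c : Fin n → ℕ) → IsFirstFit T O c → (∃ λ v → c v ≡ i)
    → Σ (ℕ → Fin n) λ p → IsBidirectedPath T O (2 * i ∸ 2) p
corollary1 T forest O (suc (suc K)) (s≤s (s≤s z≤n)) c ff (v , cv≡i)
  with FirstFit.bidirected-path-through {G = T} {O = O} ff forest cv≡i
... | p , path = p , subst (λ k → IsBidirectedPath T O k p) length≡ path
  where
    length≡ : suc K + suc K ≡ 2 * suc (suc K) ∸ 2
    length≡ = trans (cong (λ x → suc (K + suc x)) (sym (+-identityʳ K))) (sym (+-suc K _))
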